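{- Let $x,y\in\mathbb Z_{>0}$ and let $\mathrm{Speh}(x,y)$ and $\rho(x,y)$ be the multisegments defined below. Let $b=\{S_1,\dots,S_m\}$ be a multisegment with $b<\mathrm{Speh}(x,y)$ which is $\theta$-stable, i.e. the multiset $\{ -S_1,\dots,-S_m\}$ equals $\{S_1,\dots,S_m\}$. Then the following are equivalent: (i) $b=\rho(x,y)$; (ii) there are no indices $i\neq j$ with $S_i=-S_j$; (iii) $S_i=-S_i$ for all $i$.
   Context: For $a,c\in\mathbb Q$ with $c-a\in\mathbb Z$, $\langle a,c\rangle=\{a,a+1,\dots,c\}$, and $-\langle a,c\rangle=\langle -c,-a\rangle$. A multisegment is a finite multiset of nonempty segments. Segments $S,S'$ are linked if neither contains the other and $S\cup S'$ is a segment; an elementary operation replaces a linked pair $\{S,S'\}$ by $\{S\cup S',S\cap S'\}$ (omitting an empty intersection); $b<a$ means $b$ is obtained from $a$ by a chain of (zero or more) elementary operations. $\mathrm{Speh}(x,y)=\{\langle \frac{1-x}{2}+\frac{y+1-2j}{2},\frac{x-1}{2}+\frac{y+1-2j}{2}\rangle: j=1,\dots,y\}$ and $\rho(x,y)=\{\langle\frac{1-r}{2},\frac{r-1}{2}\rangle: r=x+y-1,x+y-3,\dots,|x-y|+1\}$. (Under Zelevinsky's classification, $\theta$-stability of $b$ corresponds to $Q(b)\circ\theta\cong Q(b)$ for the involution $\theta(g)=A_n\bar g^{ -t}A_n$.) -}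

module Defs where

open import Data.Nat as ℕ using (ℕ; zero; suc; _∸_; _≤_; _⊓_)
open import Data.Integer as ℤ using (ℤ; +_)
open import Data.Rational as ℚ using (ℚ; _/_)
open import Data.List using (List; []; _∷_; map; upTo)
open import Data.Product using (Σ; ∃; _×_; _,_)
open import Data.Sum using (_⊎_)
open import Relation.Nullary using (¬_)
open import Relation.Binary.PropositionalEquality using (_≡_)
open import Relation.Binary.Construct.Closure.ReflexiveTransitive using (Star)
open import Data.List.Relation.Binary.Permutation.Propositional using (_↭_)
open import Function.Bundles using (_⇔_)

-- A (nonempty) segment ⟨a, a + len⟩ = {a, a+1, ..., a+len}, a ∈ ℚ, len ∈ ℕ.
record Seg : Set where
  constructor seg
  field
    start : ℚ
    len   : ℕ
open Seg public

end : Seg → ℚ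
end S = start S ℚ.+ (+ len S / 1)

_∈ₛ_ : ℚ → Seg → Set
q ∈ₛ S = Σ ℕ λ k → k ≤ len S × q ≡ start S ℚ.+ (+ k / 1)

_⊆ₛ_ : Seg → Seg → Set
S ⊆ₛ S' = ∀ q → q ∈ₛ S → q ∈ₛ S'

negₛ : Seg → Seg
negₛ S = seg (ℚ.- end S) (len S)

IsUnion : Seg → Seg → Seg → Set
IsUnion S S' T = ∀ q → (q ∈ₛ T) ⇔ (q ∈ₛ S ⊎ q ∈ₛ S')

IsInter : Seg → Seg → Seg → Set
IsInter S S' U = ∀ q → (q ∈ₛ U) ⇔ (q ∈ₛ S × q ∈ₛ S')

Disjoint : Seg → Seg → Set
Disjoint S S' = ∀ q → ¬ (q ∈ₛ S × q ∈ₛ S')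

Linked : Seg → Seg → Set
Linked S S' = ¬ (S ⊆ₛ S') × ¬ (S' ⊆ₛ S) × ∃ (IsUnion S S')

-- multisegments: lists of segments, considered up to permutation (_↭_)
Multiseg : Set
Multiseg = List Seg

Elem : Multiseg → Multiseg → Set
Elem a b = Σ Seg λ S → Σ Seg λ S' → Σ Multiseg λ rest → Σ Seg λ T →
  a ↭ (S ∷ S' ∷ rest) × Linked S S' × IsUnion S S' T ×
  ( (Disjoint S S' × b ↭ (T ∷ rest))
  ⊎ (Σ Seg λ U → IsInter S S' U × b ↭ (T ∷ U ∷ rest)) )

_≺_ : Multiseg → Multiseg → Set
b ≺ a = Σ Multiseg λ c → Star Elem a c × c ↭ b

-- Speh(x,y): segments ⟨(1-x)/2 + (y+1-2j)/2 , (x-1)/2 + (y+1-2j)/2⟩, j = 1..y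
-- start = (2 + y - x - 2j)/2, length parameter x - 1
Speh : ℕ → ℕ → Multiseg
Speh x y = map (λ i → seg ((+ (2 ℕ.+ y) ℤ.- + x ℤ.- + (2 ℕ.* suc i)) / 2) (x ∸ 1)) (upTo y)

-- ρ(x,y): segments ⟨(1-r)/2,(r-1)/2⟩ for r = x+y-1-2k, k = 0..min(x,y)-1,
-- i.e. r - 1 = x + y - 2 - 2k, start = -(r-1)/2
ρ : ℕ → ℕ → Multiseg
ρ x y = map (λ k → seg ((ℤ.- + (x ℕ.+ y ∸ (2 ℕ.+ 2 ℕ.* k))) / 2) (x ℕ.+ y ∸ (2 ℕ.+ 2 ℕ.* k))) (upTo (x ⊓ y))

-- The number of segments of a multisegment containing a given point is unchanged by an
-- elementary operation (the union and the intersection contain it as often as the linked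
-- pair did), so b covers every point as often as Speh(x,y) does; by induction on (x,y),
-- so does ρ(x,y). A self-dual segment (−S = S) is centred, ⟨-n/2, n/2⟩, and a family of
-- centred segments is recovered from its covering numbers: the number of its segments of
-- length t is cover(t/2) − cover(t/2 + 1). Hence a b made of self-dual segments is ρ(x,y),
-- whose segments are self-dual and pairwise distinct; conversely θ-stability matches every
-- segment S of b with a segment −S, which must be S itself when no two indices match.

module Submission where

open import Defs
open import Data.Nat using (ℕ; _>_)
open import Data.Fin using (Fin)
open import Data.List using (List; map; length; lookup)
open import Data.Product using (Σ; _×_)
open import Relation.Nullary using (¬_)
open import Relation.Binary.PropositionalEquality using (_≡_; _≢_)
open import Data.List.Relation.Binary.Permutation.Propositional using (_↭_)
open import Function.Bundles using (_⇔_)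

open import Data.Empty using (⊥-elim)
open import Data.Fin as Fin using ()
open import Data.Integer as ℤ using (ℤ; +_)
import Data.Integer.Properties as ℤₚ
open import Algebra.Properties.AbelianGroup ℤₚ.+-0-abelianGroup using (∙-cancelˡ)
open import Data.Integer.Tactic.RingSolver using (solve-∀)
open import Data.List using ([]; _∷_; _++_; upTo; applyUpTo)
import Data.List.Properties as List
open import Data.List.Membership.Propositional using (_∈_)
open import Data.List.Membership.Propositional.Properties using (∈-∃++; ∈-map⁺; ∈-lookup)
open import Data.List.Relation.Binary.Permutation.Propositional
  using (↭-refl; ↭-sym; ↭-trans; ↭-prep; ↭-reflexive; ↭⇒↭ₛ)
open import Data.List.Relation.Binary.Permutation.Propositional.Properties
  using (map⁺; shift; All-resp-↭; ∈-resp-↭)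
import Data.List.Relation.Binary.Permutation.Setoid.Properties as PermutationSetoid
open import Data.List.Relation.Unary.All as All using (All)
import Data.List.Relation.Unary.All.Properties as All
open import Data.List.Relation.Unary.AllPairs using (_∷_)
import Data.List.Relation.Unary.AllPairs.Properties as AllPairs
open import Data.List.Relation.Unary.Any using (here; there)
import Data.List.Relation.Unary.Any as Any
import Data.List.Relation.Unary.Any.Properties as Any
open import Data.List.Relation.Unary.Unique.Propositional using (Unique)
open import Data.Nat as ℕ using (zero; suc; _+_; _∸_; _⊓_; _≤_; _<_; z≤n; s≤s; s≤s⁻¹)
import Data.Nat.Properties as ℕₚ
open import Algebra.Properties.CommutativeSemigroup ℕₚ.+-commutativeSemigroup using (interchange)
open import Data.Nat.ListAction using (sum)
open import Data.Nat.ListAction.Properties using (sum-↭)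
open import Data.Product using (_,_)
open import Data.Rational as ℚ using (ℚ; mkℚ; _/_; toℚᵘ)
import Data.Rational.Properties as ℚₚ
open import Data.Rational.Unnormalised as ℚᵘ using (mkℚᵘ; *≡*) renaming (_≃_ to _≃ᵘ_)
import Data.Rational.Unnormalised.Properties as ℚᵘₚ
open import Data.Sum using (_⊎_; inj₁; inj₂)
open import Function using (id; _∘_)
open import Function.Bundles using (mk⇔; Equivalence)
open import Relation.Binary.Construct.Closure.ReflexiveTransitive using (Star; ε; _◅_)
open import Relation.Binary.Definitions using (DecidableEquality)
open import Relation.Binary.PropositionalEquality
  using (refl; sym; trans; cong; cong₂; subst; setoid; module ≡-Reasoning)
open import Relation.Nullary using (Dec; yes; no; contradiction)
open import Relation.Nullary.Decidable using (_⊎-dec_; _×-dec_; map′)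
open import Relation.Unary using (Decidable)

open ≡-Reasoning
open ℚᵘₚ using (≃-trans; ≃-sym)

indicator : {P : Set} → Dec P → ℕ
indicator (yes _) = 1
indicator (no _)  = 0

indicator-⇔ : {P Q : Set} → P ⇔ Q → (p : Dec P) (q : Dec Q) → indicator p ≡ indicator q
indicator-⇔ P⇔Q (yes _) (yes _) = refl
indicator-⇔ P⇔Q (yes p) (no ¬q) = contradiction (Equivalence.to P⇔Q p) ¬q
indicator-⇔ P⇔Q (no ¬p) (yes q) = contradiction (Equivalence.from P⇔Q q) ¬p
indicator-⇔ P⇔Q (no _)  (no _)  = refl

indicator-∪∩ : {P Q R I : Set} (p : Dec P) (q : Dec Q) (r : Dec R) (i : Dec I) →
  R ⇔ (P ⊎ Q) → I ⇔ (P × Q) → indicator r + indicator i ≡ indicator p + indicator q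
indicator-∪∩ p q r i R⇔P⊎Q I⇔P×Q = begin
  indicator r + indicator i
    ≡⟨ cong₂ _+_ (indicator-⇔ R⇔P⊎Q r (p ⊎-dec q)) (indicator-⇔ I⇔P×Q i (p ×-dec q)) ⟩
  indicator (p ⊎-dec q) + indicator (p ×-dec q)
    ≡⟨ ⊎-× p q ⟩
  indicator p + indicator q ∎
  where
  ⊎-× : {P Q : Set} (p : Dec P) (q : Dec Q) →
    indicator (p ⊎-dec q) + indicator (p ×-dec q) ≡ indicator p + indicator q
  ⊎-× (yes _) (yes _) = refl
  ⊎-× (yes _) (no _)  = refl
  ⊎-× (no _)  (yes _) = refl
  ⊎-× (no _)  (no _)  = refl

indicator-⊎ : {P Q R : Set} (p : Dec P) (q : Dec Q) (r : Dec R) →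
  R ⇔ (P ⊎ Q) → ¬ (P × Q) → indicator r ≡ indicator p + indicator q
indicator-⊎ p q r R⇔P⊎Q disjoint =
  trans (sym (ℕₚ.+-identityʳ _)) (indicator-∪∩ p q r (no id) R⇔P⊎Q (mk⇔ ⊥-elim disjoint))

any≤? : {P : ℕ → Set} → Decidable P → ∀ n → Dec (Σ ℕ λ k → k ≤ n × P k)
any≤? P? n = map′ (λ (k , k<1+n , pk) → k , s≤s⁻¹ k<1+n , pk) (λ (k , k≤n , pk) → k , s≤s k≤n , pk)
  (ℕₚ.anyUpTo? P? (suc n))

_∈ₛ?_ : (q : ℚ) (S : Seg) → Dec (q ∈ₛ S)
q ∈ₛ? S = any≤? (λ k → q ℚ.≟ start S ℚ.+ + k / 1) (len S)

coverₛ : ℚ → Seg → ℕ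
coverₛ q S = indicator (q ∈ₛ? S)

cover : ℚ → Multiseg → ℕ
cover q b = sum (map (coverₛ q) b)

cover-↭ : ∀ q {a b} → a ↭ b → cover q a ≡ cover q b
cover-↭ q a↭b = sum-↭ (map⁺ (coverₛ q) a↭b)

module _ {S S' T : Seg} (q : ℚ) (S∪S'≡T : IsUnion S S' T) where

  coverₛ-∪∩ : ∀ {U} → IsInter S S' U → coverₛ q T + coverₛ q U ≡ coverₛ q S + coverₛ q S'
  coverₛ-∪∩ {U} S∩S'≡U = indicator-∪∩ (q ∈ₛ? S) (q ∈ₛ? S') (q ∈ₛ? T) (q ∈ₛ? U) (S∪S'≡T q) (S∩S'≡U q)

  coverₛ-disjoint-∪ : Disjoint S S' → coverₛ q T ≡ coverₛ q S + coverₛ q S'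
  coverₛ-disjoint-∪ disjoint = indicator-⊎ (q ∈ₛ? S) (q ∈ₛ? S') (q ∈ₛ? T) (S∪S'≡T q) (disjoint q)

cover-Elem : ∀ q {a b} → Elem a b → cover q b ≡ cover q a
cover-Elem q {a} {b} (S , S' , rest , T , a↭ , _ , S∪S'≡T , inj₁ (disjoint , b↭)) = begin
  cover q b                                ≡⟨ cover-↭ q b↭ ⟩
  coverₛ q T + cover q rest                ≡⟨ cong (_+ cover q rest) (coverₛ-disjoint-∪ {S} {S'} {T} q S∪S'≡T disjoint) ⟩
  coverₛ q S + coverₛ q S' + cover q rest  ≡⟨ ℕₚ.+-assoc (coverₛ q S) _ _ ⟩
  cover q (S ∷ S' ∷ rest)                  ≡⟨ cover-↭ q (↭-sym a↭) ⟩
  cover q a                                ∎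
cover-Elem q {a} {b} (S , S' , rest , T , a↭ , _ , S∪S'≡T , inj₂ (U , S∩S'≡U , b↭)) = begin
  cover q b                                      ≡⟨ cover-↭ q b↭ ⟩
  coverₛ q T + (coverₛ q U + cover q rest)       ≡⟨ ℕₚ.+-assoc (coverₛ q T) _ _ ⟨
  coverₛ q T + coverₛ q U + cover q rest         ≡⟨ cong (_+ cover q rest) (coverₛ-∪∩ {S} {S'} {T} q S∪S'≡T {U} S∩S'≡U) ⟩
  coverₛ q S + coverₛ q S' + cover q rest        ≡⟨ ℕₚ.+-assoc (coverₛ q S) _ _ ⟩
  cover q (S ∷ S' ∷ rest)                        ≡⟨ cover-↭ q (↭-sym a↭) ⟩
  cover q a                                      ∎

cover-≺ : ∀ q {a b} → b ≺ a → cover q b ≡ cover q a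
cover-≺ q (c , a⇒c , c↭b) = trans (cover-↭ q (↭-sym c↭b)) (cover-Star a⇒c)
  where
  cover-Star : ∀ {a c} → Star Elem a c → cover q c ≡ cover q a
  cover-Star ε        = refl
  cover-Star (e ◅ es) = trans (cover-Star es) (cover-Elem q e)

toℚᵘ-/ : ∀ t d → toℚᵘ (t / suc d) ≃ᵘ mkℚᵘ t d
toℚᵘ-/ t d = ℚₚ.toℚᵘ-fromℚᵘ (mkℚᵘ t d)

/2-injective : ∀ {t s} → t / 2 ≡ s / 2 → t ≡ s
/2-injective {t} {s} t/2≡s/2 = ℤₚ.*-cancelʳ-≡ t s (+ 2)
  (ℚᵘₚ.drop-*≡* (≃-trans (≃-sym (toℚᵘ-/ t 1)) (≃-trans (ℚₚ.toℚᵘ-cong t/2≡s/2) (toℚᵘ-/ s 1))))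

/2-+ : ∀ s k → s / 2 ℚ.+ + k / 1 ≡ (s ℤ.+ + 2 ℤ.* + k) / 2
/2-+ s k = ℚₚ.toℚᵘ-injective (≃-trans sum≃ (≃-trans (*≡* (cross s (+ k))) (≃-sym (toℚᵘ-/ (s ℤ.+ + 2 ℤ.* + k) 1))))
  where
  sum≃ : toℚᵘ (s / 2 ℚ.+ + k / 1) ≃ᵘ mkℚᵘ s 1 ℚᵘ.+ mkℚᵘ (+ k) 0
  sum≃ = ≃-trans (ℚₚ.toℚᵘ-homo-+ (s / 2) (+ k / 1)) (ℚᵘₚ.+-cong (toℚᵘ-/ s 1) (toℚᵘ-/ (+ k) 0))
  cross : ∀ s k → (s ℤ.* + 1 ℤ.+ k ℤ.* + 2) ℤ.* + 2 ≡ (s ℤ.+ + 2 ℤ.* k) ℤ.* + 2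
  cross = solve-∀

-/2 : ∀ s → ℚ.- (s / 2) ≡ (ℤ.- s) / 2
-/2 s = ℚₚ.toℚᵘ-injective (≃-trans (ℚₚ.toℚᵘ-homo‿- (s / 2))
  (≃-trans (ℚᵘₚ.-‿cong (toℚᵘ-/ s 1)) (≃-sym (toℚᵘ-/ (ℤ.- s) 1))))

centred : ℕ → Seg
centred n = seg ((ℤ.- + n) / 2) n

negₛ-centred : ∀ n → negₛ (centred n) ≡ centred n
negₛ-centred n = cong (λ a → seg a n) (begin
  ℚ.- ((ℤ.- + n) / 2 ℚ.+ + n / 1)              ≡⟨ cong ℚ.-_ (/2-+ (ℤ.- + n) n) ⟩
  ℚ.- ((ℤ.- + n ℤ.+ + 2 ℤ.* + n) / 2)          ≡⟨ -/2 (ℤ.- + n ℤ.+ + 2 ℤ.* + n) ⟩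
  (ℤ.- (ℤ.- + n ℤ.+ + 2 ℤ.* + n)) / 2          ≡⟨ cong (_/ 2) (reflect (+ n)) ⟩
  (ℤ.- + n) / 2                                ∎)
  where
  reflect : ∀ m → ℤ.- (ℤ.- m ℤ.+ + 2 ℤ.* m) ≡ ℤ.- m
  reflect = solve-∀

neg-fixed-point : ∀ a n → a ≡ ℚ.- (a ℚ.+ + n / 1) → a ≡ (ℤ.- + n) / 2
neg-fixed-point a@(mkℚ p d _) n a≡ =
  ℚₚ.toℚᵘ-injective (≃-trans (*≡* doubled) (≃-sym (toℚᵘ-/ (ℤ.- + n) 1)))
  where
  D : ℤ
  D = + suc d
  fixed : mkℚᵘ p d ≃ᵘ ℚᵘ.- (mkℚᵘ p d ℚᵘ.+ mkℚᵘ (+ n) 0)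
  fixed = ≃-trans (ℚₚ.toℚᵘ-cong a≡) (≃-trans (ℚₚ.toℚᵘ-homo‿- (a ℚ.+ + n / 1))
    (ℚᵘₚ.-‿cong (≃-trans (ℚₚ.toℚᵘ-homo-+ a (+ n / 1)) (ℚᵘₚ.+-congʳ (mkℚᵘ p d) (toℚᵘ-/ (+ n) 0)))))
  cross : p ℤ.* D ≡ ℤ.- (p ℤ.* + 1 ℤ.+ + n ℤ.* D) ℤ.* D
  cross = trans (cong (λ m → p ℤ.* + m) (sym (ℕₚ.*-identityʳ (suc d)))) (ℚᵘₚ.drop-*≡* fixed)
  halve : ∀ p m → p ≡ ℤ.- (p ℤ.* + 1 ℤ.+ m) → p ℤ.* + 2 ≡ ℤ.- m
  halve p m p≡ = begin
    p ℤ.* + 2                     ≡⟨ twice p ⟩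
    p ℤ.+ p                       ≡⟨ cong (λ q → p ℤ.+ q) p≡ ⟩
    p ℤ.+ ℤ.- (p ℤ.* + 1 ℤ.+ m)   ≡⟨ cancel p m ⟩
    ℤ.- m                         ∎
    where
    twice : ∀ p → p ℤ.* + 2 ≡ p ℤ.+ p
    twice = solve-∀
    cancel : ∀ p m → p ℤ.+ ℤ.- (p ℤ.* + 1 ℤ.+ m) ≡ ℤ.- m
    cancel = solve-∀
  doubled : p ℤ.* + 2 ≡ ℤ.- + n ℤ.* D
  doubled = trans (halve p (+ n ℤ.* D) (ℤₚ.*-cancelʳ-≡ p _ D cross)) (ℤₚ.neg-distribˡ-* (+ n) D)

self-dual⇒centred : ∀ S → S ≡ negₛ S → S ≡ centred (len S)
self-dual⇒centred (seg a n) S≡ = cong (λ a → seg a n) (neg-fixed-point a n (cong start S≡))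

-- Coordinates are doubled: t/2 ∈ ⟨s/2, s/2 + n⟩ iff t is one of the n + 1 terms s, s+2, …
OnProg : ℤ → ℤ → ℕ → Set
OnProg t s m = Σ ℕ λ k → k < m × t ≡ s ℤ.+ + 2 ℤ.* + k

onProg? : ∀ t s m → Dec (OnProg t s m)
onProg? t s = ℕₚ.anyUpTo? (λ k → t ℤ.≟ s ℤ.+ + 2 ℤ.* + k)

hits : ℤ → ℤ → ℕ → ℕ
hits t s m = indicator (onProg? t s m)

point : ℤ → ℤ → ℕ
point t u = indicator (t ℤ.≟ u)

∈ₛ-/2⇔OnProg : ∀ (t s : ℤ) n → ((t / 2) ∈ₛ seg (s / 2) n) ⇔ OnProg t s (suc n)
∈ₛ-/2⇔OnProg t s n = mk⇔
  (λ (k , k≤n , t/2≡) → k , s≤s k≤n , /2-injective (trans t/2≡ (/2-+ s k)))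
  (λ (k , k<1+n , t≡) → k , s≤s⁻¹ k<1+n , trans (cong (_/ 2) t≡) (sym (/2-+ s k)))

coverₛ-/2 : ∀ (t s : ℤ) n → coverₛ (t / 2) (seg (s / 2) n) ≡ hits t s (suc n)
coverₛ-/2 t s n = indicator-⇔ (∈ₛ-/2⇔OnProg t s n) _ _

hits-suc : ∀ t s m → hits t s (suc m) ≡ hits t s m + point t (s ℤ.+ + 2 ℤ.* + m)
hits-suc t s m = indicator-⊎ (onProg? t s m) (t ℤ.≟ _) (onProg? t s (suc m)) (mk⇔ split join) disjoint
  where
  split : OnProg t s (suc m) → OnProg t s m ⊎ t ≡ s ℤ.+ + 2 ℤ.* + m
  split (k , k<1+m , t≡) with ℕₚ.m≤n⇒m<n∨m≡n (s≤s⁻¹ k<1+m)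
  ... | inj₁ k<m  = inj₁ (k , k<m , t≡)
  ... | inj₂ refl = inj₂ t≡
  join : OnProg t s m ⊎ t ≡ s ℤ.+ + 2 ℤ.* + m → OnProg t s (suc m)
  join (inj₁ (k , k<m , t≡)) = k , ℕₚ.m≤n⇒m≤1+n k<m , t≡
  join (inj₂ t≡)             = m , ℕₚ.≤-refl , t≡
  disjoint : ¬ (OnProg t s m × t ≡ s ℤ.+ + 2 ℤ.* + m)
  disjoint ((k , k<m , t≡) , t≡′) =
    ℕₚ.<⇒≢ k<m (ℤₚ.+-injective (ℤₚ.*-cancelˡ-≡ (+ 2) _ _ (∙-cancelˡ s _ _ (trans (sym t≡) t≡′))))

hitsᶜ : ℤ → ℕ → ℕ
hitsᶜ t n = hits t (ℤ.- + n) (suc n)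

∑< : ℕ → (ℕ → ℕ) → ℕ
∑< zero    f = 0
∑< (suc n) f = ∑< n f + f n

syntax ∑< n (λ i → e) = ∑[ i < n ] e

∑-cong : ∀ n {f g : ℕ → ℕ} → (∀ i → f i ≡ g i) → ∑< n f ≡ ∑< n g
∑-cong zero    f≗g = refl
∑-cong (suc n) f≗g = cong₂ _+_ (∑-cong n f≗g) (f≗g n)

∑-zero : ∀ n → ∑[ i < n ] 0 ≡ 0
∑-zero zero    = refl
∑-zero (suc n) = cong (_+ 0) (∑-zero n)

∑-front : ∀ n f → ∑< (suc n) f ≡ f 0 + ∑[ i < n ] f (suc i)
∑-front zero    f = ℕₚ.+-comm 0 (f 0)
∑-front (suc n) f = trans (cong (_+ f (suc n)) (∑-front n f)) (ℕₚ.+-assoc (f 0) _ _)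

∑-+ : ∀ n f g → ∑[ i < n ] (f i + g i) ≡ ∑< n f + ∑< n g
∑-+ zero    f g = refl
∑-+ (suc n) f g = trans (cong (_+ (f n + g n)) (∑-+ n f g)) (interchange (∑< n f) (∑< n g) (f n) (g n))

cover-map-applyUpTo : ∀ q (g : ℕ → Seg) f n → cover q (map g (applyUpTo f n)) ≡ ∑[ i < n ] coverₛ q (g (f i))
cover-map-applyUpTo q g f zero    = refl
cover-map-applyUpTo q g f (suc n) = begin
  coverₛ q (g (f 0)) + cover q (map g (applyUpTo (λ i → f (suc i)) n))
    ≡⟨ cong (λ z → coverₛ q (g (f 0)) + z) (cover-map-applyUpTo q g (λ i → f (suc i)) n) ⟩
  coverₛ q (g (f 0)) + ∑[ i < n ] coverₛ q (g (f (suc i)))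
    ≡⟨ ∑-front n (λ i → coverₛ q (g (f i))) ⟨
  ∑[ i < suc n ] coverₛ q (g (f i)) ∎

+suc : ∀ n → + suc n ≡ + 1 ℤ.+ + n
+suc = ℤₚ.pos-+ 1

spehStart : ℕ → ℕ → ℕ → ℤ
spehStart x y i = + y ℤ.- + x ℤ.- + 2 ℤ.* + i

spehStart-Speh : ∀ x y i → + (2 + y) ℤ.- + x ℤ.- + (2 ℕ.* suc i) ≡ spehStart x y i
spehStart-Speh x y i =
  trans (cong₂ (λ u v → u ℤ.- + x ℤ.- v) (ℤₚ.pos-+ 2 y) (trans (ℤₚ.pos-* 2 (suc i)) (cong (λ j → + 2 ℤ.* j) (+suc i))))
        (by-ring (+ x) (+ y) (+ i))
  where
  by-ring : ∀ x y i → + 2 ℤ.+ y ℤ.- x ℤ.- + 2 ℤ.* (+ 1 ℤ.+ i) ≡ y ℤ.- x ℤ.- + 2 ℤ.* i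
  by-ring = solve-∀

spehStart-suc : ∀ x y i → spehStart (suc x) (suc y) i ≡ spehStart x y i
spehStart-suc x y i =
  trans (cong₂ (λ u v → u ℤ.- v ℤ.- + 2 ℤ.* + i) (+suc y) (+suc x)) (by-ring (+ x) (+ y) (+ i))
  where
  by-ring : ∀ x y i → + 1 ℤ.+ y ℤ.- (+ 1 ℤ.+ x) ℤ.- + 2 ℤ.* i ≡ y ℤ.- x ℤ.- + 2 ℤ.* i
  by-ring = solve-∀

spehStart-end : ∀ x y i → spehStart x y i ℤ.+ + 2 ℤ.* + x ≡ + (x + y) ℤ.- + 2 ℤ.* + i
spehStart-end x y i = trans (by-ring (+ x) (+ y) (+ i)) (cong (λ u → u ℤ.- + 2 ℤ.* + i) (sym (ℤₚ.pos-+ x y)))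
  where
  by-ring : ∀ x y i → y ℤ.- x ℤ.- + 2 ℤ.* i ℤ.+ + 2 ℤ.* x ≡ x ℤ.+ y ℤ.- + 2 ℤ.* i
  by-ring = solve-∀

spehStart-last : ∀ x y → spehStart x y y ≡ ℤ.- + (x + y)
spehStart-last x y = trans (by-ring (+ x) (+ y)) (cong ℤ.-_ (sym (ℤₚ.pos-+ x y)))
  where
  by-ring : ∀ x y → y ℤ.- x ℤ.- + 2 ℤ.* y ≡ ℤ.- (x ℤ.+ y)
  by-ring = solve-∀

cover-Speh : ∀ a y t → cover (t / 2) (Speh (suc a) y) ≡ ∑[ i < y ] hits t (spehStart (suc a) y i) (suc a)
cover-Speh a y t = trans (cover-map-applyUpTo (t / 2) _ id y) (∑-cong y (λ i →
  trans (cong (λ s → coverₛ (t / 2) (seg (s / 2) a)) (spehStart-Speh (suc a) y i)) (coverₛ-/2 t (spehStart (suc a) y i) a)))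

ρLength : ℕ → ℕ → ℕ → ℕ
ρLength x y k = x + y ∸ (2 + 2 ℕ.* k)

cover-ρ : ∀ x y t → cover (t / 2) (ρ x y) ≡ ∑[ k < x ⊓ y ] hitsᶜ t (ρLength x y k)
cover-ρ x y t = trans (cover-map-applyUpTo (t / 2) _ id (x ⊓ y)) (∑-cong (x ⊓ y) (λ k → coverₛ-/2 t (ℤ.- + ρLength x y k) (ρLength x y k)))

hitsᶜ-split : ∀ y m t →
  ∑[ i < y ] point t (+ (m + y) ℤ.- + 2 ℤ.* + i) + hits t (ℤ.- + (m + y)) (suc m) ≡ hitsᶜ t (m + y)
hitsᶜ-split zero    m t = cong (λ n → hits t (ℤ.- + (m + 0)) (suc n)) (sym (ℕₚ.+-identityʳ m))
hitsᶜ-split (suc y) m t = begin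
  ∑[ i < suc y ] point t (+ (m + suc y) ℤ.- + 2 ℤ.* + i) + hits t (ℤ.- + (m + suc y)) (suc m)
    ≡⟨ cong (λ n → ∑[ i < suc y ] point t (+ n ℤ.- + 2 ℤ.* + i) + hits t (ℤ.- + n) (suc m)) (ℕₚ.+-suc m y) ⟩
  ∑< y F + F y + hits t s (suc m)                         ≡⟨ ℕₚ.+-assoc (∑< y F) _ _ ⟩
  ∑< y F + (F y + hits t s (suc m))                       ≡⟨ cong (λ z → ∑< y F + z) (ℕₚ.+-comm (F y) _) ⟩
  ∑< y F + (hits t s (suc m) + F y)                       ≡⟨ cong (λ u → ∑< y F + (hits t s (suc m) + point t u)) last≡ ⟩
  ∑< y F + (hits t s (suc m) + point t (s ℤ.+ + 2 ℤ.* + suc m))  ≡⟨ cong (λ z → ∑< y F + z) (hits-suc t s (suc m)) ⟨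
  ∑< y F + hits t s (suc (suc m))                         ≡⟨ hitsᶜ-split y (suc m) t ⟩
  hitsᶜ t (suc (m + y))                                   ≡⟨ cong (hitsᶜ t) (ℕₚ.+-suc m y) ⟨
  hitsᶜ t (m + suc y)                                     ∎
  where
  F : ℕ → ℕ
  F i = point t (+ suc (m + y) ℤ.- + 2 ℤ.* + i)
  s : ℤ
  s = ℤ.- + suc (m + y)
  by-ring : ∀ m y → + 1 ℤ.+ (m ℤ.+ y) ℤ.- + 2 ℤ.* y ≡ ℤ.- (+ 1 ℤ.+ (m ℤ.+ y)) ℤ.+ + 2 ℤ.* (+ 1 ℤ.+ m)
  by-ring = solve-∀
  last≡ : + suc (m + y) ℤ.- + 2 ℤ.* + y ≡ s ℤ.+ + 2 ℤ.* + suc m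
  last≡ = begin
    + suc (m + y) ℤ.- + 2 ℤ.* + y                            ≡⟨ cong (λ u → u ℤ.- + 2 ℤ.* + y) m+y+1 ⟩
    + 1 ℤ.+ (+ m ℤ.+ + y) ℤ.- + 2 ℤ.* + y                    ≡⟨ by-ring (+ m) (+ y) ⟩
    ℤ.- (+ 1 ℤ.+ (+ m ℤ.+ + y)) ℤ.+ + 2 ℤ.* (+ 1 ℤ.+ + m)    ≡⟨ cong₂ (λ u v → ℤ.- u ℤ.+ + 2 ℤ.* v) m+y+1 (+suc m) ⟨
    s ℤ.+ + 2 ℤ.* + suc m                                    ∎
    where
    m+y+1 : + suc (m + y) ≡ + 1 ℤ.+ (+ m ℤ.+ + y)
    m+y+1 = trans (+suc (m + y)) (cong (λ u → + 1 ℤ.+ u) (ℤₚ.pos-+ m y))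

ρLength-zero : ∀ x y → ρLength (suc x) (suc y) 0 ≡ x + y
ρLength-zero x y = cong (_∸ 1) (ℕₚ.+-suc x y)

ρLength-suc : ∀ x y k → ρLength (suc x) (suc y) (suc k) ≡ ρLength x y k
ρLength-suc x y k = cong₂ (λ u v → suc u ∸ (2 + v)) (ℕₚ.+-suc x y) (ℕₚ.*-suc 2 k)

-- Speh(x+1,y+1) is Speh(x,y) with one point appended to each segment, plus one segment of
-- x+1 points. The appended points and that segment together cover like the longest segment
-- of ρ(x+1,y+1) (hitsᶜ-split); the other segments of ρ(x+1,y+1) are those of ρ(x,y).
spehHits≡ρHits : ∀ x y t →
  ∑[ i < y ] hits t (spehStart x y i) x ≡ ∑[ k < x ⊓ y ] hitsᶜ t (ρLength x y k)
spehHits≡ρHits zero    y       t = ∑-zero y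
spehHits≡ρHits (suc x) zero    t = refl
spehHits≡ρHits (suc x) (suc y) t = begin
  ∑[ i < y ] hits t (spehStart (suc x) (suc y) i) (suc x) + hits t (spehStart (suc x) (suc y) y) (suc x)
    ≡⟨ cong₂ _+_ (∑-cong y split) (cong (λ s → hits t s (suc x)) (trans (spehStart-suc x y y) (spehStart-last x y))) ⟩
  ∑[ i < y ] (hits t (spehStart x y i) x + P i) + extra
    ≡⟨ cong (_+ extra) (∑-+ y _ P) ⟩
  ∑[ i < y ] hits t (spehStart x y i) x + ∑< y P + extra
    ≡⟨ ℕₚ.+-assoc (∑[ i < y ] hits t (spehStart x y i) x) _ _ ⟩
  ∑[ i < y ] hits t (spehStart x y i) x + (∑< y P + extra)
    ≡⟨ cong₂ _+_ (spehHits≡ρHits x y t) (hitsᶜ-split y x t) ⟩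
  ∑[ k < x ⊓ y ] hitsᶜ t (ρLength x y k) + hitsᶜ t (x + y)
    ≡⟨ ℕₚ.+-comm (∑[ k < x ⊓ y ] hitsᶜ t (ρLength x y k)) _ ⟩
  hitsᶜ t (x + y) + ∑[ k < x ⊓ y ] hitsᶜ t (ρLength x y k)
    ≡⟨ cong₂ _+_ (cong (hitsᶜ t) (ρLength-zero x y)) (∑-cong (x ⊓ y) (λ k → cong (hitsᶜ t) (ρLength-suc x y k))) ⟨
  hitsᶜ t (ρLength (suc x) (suc y) 0) + ∑[ k < x ⊓ y ] hitsᶜ t (ρLength (suc x) (suc y) (suc k))
    ≡⟨ ∑-front (x ⊓ y) (λ k → hitsᶜ t (ρLength (suc x) (suc y) k)) ⟨
  ∑[ k < suc x ⊓ suc y ] hitsᶜ t (ρLength (suc x) (suc y) k) ∎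
  where
  P : ℕ → ℕ
  P i = point t (+ (x + y) ℤ.- + 2 ℤ.* + i)
  extra : ℕ
  extra = hits t (ℤ.- + (x + y)) (suc x)
  split : ∀ i → hits t (spehStart (suc x) (suc y) i) (suc x) ≡ hits t (spehStart x y i) x + P i
  split i = begin
    hits t (spehStart (suc x) (suc y) i) (suc x)
      ≡⟨ cong (λ s → hits t s (suc x)) (spehStart-suc x y i) ⟩
    hits t (spehStart x y i) (suc x)
      ≡⟨ hits-suc t (spehStart x y i) x ⟩
    hits t (spehStart x y i) x + point t (spehStart x y i ℤ.+ + 2 ℤ.* + x)
      ≡⟨ cong (λ u → hits t (spehStart x y i) x + point t u) (spehStart-end x y i) ⟩
    hits t (spehStart x y i) x + P i ∎

cover-Speh≡cover-ρ : ∀ a y t → cover (t / 2) (Speh (suc a) y) ≡ cover (t / 2) (ρ (suc a) y)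
cover-Speh≡cover-ρ a y t =
  trans (cover-Speh a y t) (trans (spehHits≡ρHits (suc a) y t) (sym (cover-ρ (suc a) y t)))

module _ {A : Set} (_≟_ : DecidableEquality A) where

  multiplicity : A → List A → ℕ
  multiplicity a xs = sum (map (λ x → indicator (a ≟ x)) xs)

  multiplicity-↭ : ∀ a {xs ys} → xs ↭ ys → multiplicity a xs ≡ multiplicity a ys
  multiplicity-↭ a xs↭ys = sum-↭ (map⁺ _ xs↭ys)

  ∈⇒multiplicity>0 : ∀ {a} xs → a ∈ xs → multiplicity a xs > 0
  ∈⇒multiplicity>0 {a} (_ ∷ _) (here refl) with a ≟ a
  ... | yes _   = s≤s z≤n
  ... | no a≢a  = contradiction refl a≢a
  ∈⇒multiplicity>0 (_ ∷ xs) (there a∈xs) = ℕₚ.<-≤-trans (∈⇒multiplicity>0 xs a∈xs) (ℕₚ.m≤n+m _ _)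

  multiplicity>0⇒∈ : ∀ {a} xs → multiplicity a xs > 0 → a ∈ xs
  multiplicity>0⇒∈ {a} (x ∷ xs) positive with a ≟ x
  ... | yes refl = here refl
  ... | no _     = there (multiplicity>0⇒∈ xs positive)

  multiplicity-≡⇒↭ : ∀ xs ys → (∀ a → multiplicity a xs ≡ multiplicity a ys) → xs ↭ ys
  multiplicity-≡⇒↭ []       []       _    = ↭-refl
  multiplicity-≡⇒↭ []       (y ∷ ys) same =
    contradiction (subst (_> 0) (sym (same y)) (∈⇒multiplicity>0 (y ∷ ys) (here refl))) (ℕₚ.n≮n 0)
  multiplicity-≡⇒↭ (x ∷ xs) ys       same
    with hs , ts , refl ← ∈-∃++ (multiplicity>0⇒∈ ys (subst (_> 0) (same x) (∈⇒multiplicity>0 (x ∷ xs) (here refl))))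
    = ↭-trans (↭-prep x (multiplicity-≡⇒↭ xs (hs ++ ts) same′)) (↭-sym (shift x hs ts))
    where
    same′ : ∀ a → multiplicity a xs ≡ multiplicity a (hs ++ ts)
    same′ a = ℕₚ.+-cancelˡ-≡ (indicator (a ≟ x)) _ _ (trans (same a) (multiplicity-↭ a (shift x hs ts)))

centred-point⇔ : ∀ t n k → (+ t ≡ ℤ.- + n ℤ.+ + 2 ℤ.* + k) ⇔ (t + n ≡ 2 ℕ.* k)
centred-point⇔ t n k = mk⇔ to from
  where
  cancel : ∀ u v → ℤ.- v ℤ.+ u ℤ.+ v ≡ u
  cancel = solve-∀
  restore : ∀ u v → u ≡ ℤ.- v ℤ.+ (u ℤ.+ v)
  restore = solve-∀
  to : + t ≡ ℤ.- + n ℤ.+ + 2 ℤ.* + k → t + n ≡ 2 ℕ.* k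
  to t≡ = ℤₚ.+-injective (begin
    + (t + n)                           ≡⟨ ℤₚ.pos-+ t n ⟩
    + t ℤ.+ + n                         ≡⟨ cong (ℤ._+ + n) t≡ ⟩
    ℤ.- + n ℤ.+ + 2 ℤ.* + k ℤ.+ + n     ≡⟨ cancel (+ 2 ℤ.* + k) (+ n) ⟩
    + 2 ℤ.* + k                         ≡⟨ ℤₚ.pos-* 2 k ⟨
    + (2 ℕ.* k)                         ∎)
  from : t + n ≡ 2 ℕ.* k → + t ≡ ℤ.- + n ℤ.+ + 2 ℤ.* + k
  from t+n≡ = begin
    + t                                 ≡⟨ restore (+ t) (+ n) ⟩
    ℤ.- + n ℤ.+ (+ t ℤ.+ + n)           ≡⟨ cong (λ u → ℤ.- + n ℤ.+ u) (trans (sym (ℤₚ.pos-+ t n)) (trans (cong +_ t+n≡) (ℤₚ.pos-* 2 k))) ⟩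
    ℤ.- + n ℤ.+ + 2 ℤ.* + k             ∎

-- A centred segment of length n covers t/2 (t ≥ 0) iff t ≤ n and t ≡ n mod 2.
hitsᶜ-step : ∀ t n → hitsᶜ (+ t) n ≡ indicator (t ℕ.≟ n) + hitsᶜ (+ (2 + t)) n
hitsᶜ-step t n =
  indicator-⊎ (t ℕ.≟ n) (onProg? (+ (2 + t)) (ℤ.- + n) (suc n)) (onProg? (+ t) (ℤ.- + n) (suc n))
    (mk⇔ split join) disjoint
  where
  open Equivalence
  twice : ∀ m → 2 ℕ.* m ≡ m + m
  twice m = cong (λ n → m + n) (ℕₚ.+-identityʳ m)
  split : OnProg (+ t) (ℤ.- + n) (suc n) → t ≡ n ⊎ OnProg (+ (2 + t)) (ℤ.- + n) (suc n)
  split (k , k<1+n , t≡) with ℕₚ.m≤n⇒m<n∨m≡n (s≤s⁻¹ k<1+n)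
  ... | inj₂ refl = inj₁ (ℕₚ.+-cancelʳ-≡ k t k (trans (to (centred-point⇔ t k k) t≡) (twice k)))
  ... | inj₁ k<n  = inj₂ (suc k , s≤s k<n ,
        from (centred-point⇔ (2 + t) n (suc k)) (trans (cong (λ m → 2 + m) (to (centred-point⇔ t n k) t≡)) (sym (ℕₚ.*-suc 2 k))))
  join : t ≡ n ⊎ OnProg (+ (2 + t)) (ℤ.- + n) (suc n) → OnProg (+ t) (ℤ.- + n) (suc n)
  join (inj₁ refl) = t , ℕₚ.≤-refl , from (centred-point⇔ t t t) (sym (twice t))
  join (inj₂ (zero , _ , 2+t≡)) with () ← to (centred-point⇔ (2 + t) n 0) 2+t≡
  join (inj₂ (suc k , 1+k<1+n , 2+t≡)) = k , ℕₚ.m<n⇒m<1+n (s≤s⁻¹ 1+k<1+n) ,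
    from (centred-point⇔ t n k) (ℕₚ.+-cancelˡ-≡ 2 _ _ (trans (to (centred-point⇔ (2 + t) n (suc k)) 2+t≡) (ℕₚ.*-suc 2 k)))
  disjoint : ¬ (t ≡ n × OnProg (+ (2 + t)) (ℤ.- + n) (suc n))
  disjoint (refl , k , k<1+t , 2+t≡) = ℕₚ.n≮n (t + t) (ℕₚ.≤-trans (ℕₚ.n≤1+n _) 2+2t≤2t)
    where
    2+2t≤2t : 2 + (t + t) ≤ t + t
    2+2t≤2t = ℕₚ.≤-trans (ℕₚ.≤-reflexive (to (centred-point⇔ (2 + t) t k) 2+t≡))
                (ℕₚ.≤-trans (ℕₚ.*-monoʳ-≤ 2 (s≤s⁻¹ k<1+t)) (ℕₚ.≤-reflexive (twice t)))

cover-map-centred : ∀ t ns → cover (t / 2) (map centred ns) ≡ sum (map (hitsᶜ t) ns)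
cover-map-centred t []       = refl
cover-map-centred t (n ∷ ns) = cong₂ _+_ (coverₛ-/2 t (ℤ.- + n) n) (cover-map-centred t ns)

hitsᶜ-telescope : ∀ t ns →
  sum (map (hitsᶜ (+ t)) ns) ≡ multiplicity ℕ._≟_ t ns + sum (map (hitsᶜ (+ (2 + t))) ns)
hitsᶜ-telescope t []       = refl
hitsᶜ-telescope t (n ∷ ns) = trans (cong₂ _+_ (hitsᶜ-step t n) (hitsᶜ-telescope t ns))
  (interchange (indicator (t ℕ.≟ n)) (hitsᶜ (+ (2 + t)) n) (multiplicity ℕ._≟_ t ns) (sum (map (hitsᶜ (+ (2 + t))) ns)))

centred-cover-≡⇒↭ : ∀ ms ns → (∀ t → cover (+ t / 2) (map centred ms) ≡ cover (+ t / 2) (map centred ns)) → ms ↭ ns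
centred-cover-≡⇒↭ ms ns same-cover = multiplicity-≡⇒↭ ℕ._≟_ ms ns λ t →
  ℕₚ.+-cancelʳ-≡ (H (2 + t) ms) _ _ (begin
    multiplicity ℕ._≟_ t ms + H (2 + t) ms  ≡⟨ hitsᶜ-telescope t ms ⟨
    H t ms                                 ≡⟨ same-H t ⟩
    H t ns                                 ≡⟨ hitsᶜ-telescope t ns ⟩
    multiplicity ℕ._≟_ t ns + H (2 + t) ns  ≡⟨ cong (λ h → multiplicity ℕ._≟_ t ns + h) (same-H (2 + t)) ⟨
    multiplicity ℕ._≟_ t ns + H (2 + t) ms  ∎)
  where
  H : ℕ → List ℕ → ℕ
  H t xs = sum (map (hitsᶜ (+ t)) xs)
  same-H : ∀ t → H t ms ≡ H t ns
  same-H t = trans (sym (cover-map-centred (+ t) ms)) (trans (same-cover t) (cover-map-centred (+ t) ns))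

AllSelfDual : Multiseg → Set
AllSelfDual b = ∀ i → lookup b i ≡ negₛ (lookup b i)

HasDualPair : Multiseg → Set
HasDualPair b = Σ (Fin (length b)) λ i → Σ (Fin (length b)) λ j → i ≢ j × lookup b i ≡ negₛ (lookup b j)

AllSelfDual⇒map-centred : ∀ b → AllSelfDual b → b ≡ map centred (map len b)
AllSelfDual⇒map-centred []      _      = refl
AllSelfDual⇒map-centred (S ∷ b) selfDual =
  cong₂ _∷_ (self-dual⇒centred S (selfDual Fin.zero)) (AllSelfDual⇒map-centred b (selfDual ∘ Fin.suc))

ρLengths : ℕ → ℕ → List ℕ
ρLengths x y = map (ρLength x y) (upTo (x ⊓ y))

ρ≡map-centred : ∀ x y → ρ x y ≡ map centred (ρLengths x y)
ρ≡map-centred x y = List.map-∘ (upTo (x ⊓ y))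

ρLength-bound : ∀ x y {k} → k < x ⊓ y → 2 + 2 ℕ.* k ≤ x + y
ρLength-bound x y {k} k<x⊓y =
  ℕₚ.≤-trans (ℕₚ.≤-reflexive (sym (ℕₚ.*-suc 2 k)))
    (ℕₚ.≤-trans (ℕₚ.*-monoʳ-≤ 2 k<x⊓y)
      (ℕₚ.+-mono-≤ (ℕₚ.m⊓n≤m x y) (ℕₚ.≤-trans (ℕₚ.≤-reflexive (ℕₚ.+-identityʳ (x ⊓ y))) (ℕₚ.m⊓n≤n x y))))

ρLength-injective : ∀ x y {i j} → i < x ⊓ y → j < x ⊓ y → ρLength x y i ≡ ρLength x y j → i ≡ j
ρLength-injective x y {i} {j} i< j< ρi≡ρj =
  ℕₚ.*-cancelˡ-≡ i j 2 (ℕₚ.+-cancelˡ-≡ 2 _ _ (ℕₚ.∸-cancelˡ-≡ (ρLength-bound x y i<) (ρLength-bound x y j<) ρi≡ρj))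

ρ-unique : ∀ x y → Unique (ρ x y)
ρ-unique x y = AllPairs.map⁺ (AllPairs.applyUpTo⁺₁ id (x ⊓ y) λ i<j j<m ρi≡ρj →
  ℕₚ.<⇒≢ i<j (ρLength-injective x y (ℕₚ.<-trans i<j j<m) j<m (cong len ρi≡ρj)))

ρ-selfDual : ∀ x y → All (λ S → S ≡ negₛ S) (ρ x y)
ρ-selfDual x y = All.map⁺ (All.universal (λ k → sym (negₛ-centred (ρLength x y k))) (upTo (x ⊓ y)))

AllSelfDual-≺-Speh⇒↭ρ : ∀ {x y b} → x > 0 → b ≺ Speh x y → AllSelfDual b → b ↭ ρ x y
AllSelfDual-≺-Speh⇒↭ρ {suc a} {y} {b} _ b≺Speh selfDual =
  ↭-trans (↭-reflexive (AllSelfDual⇒map-centred b selfDual))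
    (↭-trans (map⁺ centred (centred-cover-≡⇒↭ (map len b) (ρLengths (suc a) y) same-cover))
      (↭-reflexive (sym (ρ≡map-centred (suc a) y))))
  where
  same-cover : ∀ t → cover (+ t / 2) (map centred (map len b)) ≡ cover (+ t / 2) (map centred (ρLengths (suc a) y))
  same-cover t = begin
    cover (+ t / 2) (map centred (map len b))          ≡⟨ cong (cover (+ t / 2)) (AllSelfDual⇒map-centred b selfDual) ⟨
    cover (+ t / 2) b                                  ≡⟨ cover-≺ (+ t / 2) b≺Speh ⟩
    cover (+ t / 2) (Speh (suc a) y)                   ≡⟨ cover-Speh≡cover-ρ a y (+ t) ⟩
    cover (+ t / 2) (ρ (suc a) y)                      ≡⟨ cong (cover (+ t / 2)) (ρ≡map-centred (suc a) y) ⟩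
    cover (+ t / 2) (map centred (ρLengths (suc a) y)) ∎

Unique-lookup-injective : ∀ {A : Set} {xs : List A} → Unique xs → ∀ {i j} → i ≢ j → lookup xs i ≢ lookup xs j
Unique-lookup-injective (_ ∷ _)        {Fin.zero}  {Fin.zero}  i≢j = contradiction refl i≢j
Unique-lookup-injective (x≢xs ∷ _)     {Fin.zero}  {Fin.suc j} _   = All.lookup x≢xs (∈-lookup j)
Unique-lookup-injective (x≢xs ∷ _)     {Fin.suc i} {Fin.zero}  _   = All.lookup x≢xs (∈-lookup i) ∘ sym
Unique-lookup-injective (_ ∷ unique)   {Fin.suc i} {Fin.suc j} i≢j =
  Unique-lookup-injective unique (i≢j ∘ cong Fin.suc)

↭ρ⇒AllSelfDual : ∀ {x y b} → b ↭ ρ x y → AllSelfDual b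
↭ρ⇒AllSelfDual {x} {y} b↭ρ i = All.lookup (All-resp-↭ (↭-sym b↭ρ) (ρ-selfDual x y)) (∈-lookup i)

↭ρ⇒¬HasDualPair : ∀ {x y b} → b ↭ ρ x y → ¬ HasDualPair b
↭ρ⇒¬HasDualPair {x} {y} {b} b↭ρ (i , j , i≢j , bi≡-bj) =
  Unique-lookup-injective unique i≢j (trans bi≡-bj (sym (↭ρ⇒AllSelfDual b↭ρ j)))
  where
  unique : Unique b
  unique = PermutationSetoid.Unique-resp-↭ (setoid Seg) (↭⇒↭ₛ (↭-sym b↭ρ)) (ρ-unique x y)

θ-stable∧¬HasDualPair⇒AllSelfDual : ∀ {b} → map negₛ b ↭ b → ¬ HasDualPair b → AllSelfDual b
θ-stable∧¬HasDualPair⇒AllSelfDual {b} θ-stable noDualPair i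
  with -bi∈b ← ∈-resp-↭ θ-stable (∈-map⁺ negₛ (∈-lookup i))
  with Any.index -bi∈b Fin.≟ i
... | yes j≡i  = sym (subst (λ j → negₛ (lookup b i) ≡ lookup b j) j≡i (Any.lookup-index -bi∈b))
... | no j≢i   = contradiction (Any.index -bi∈b , i , j≢i , sym (Any.lookup-index -bi∈b)) noDualPair

lemma3p3p1 : (x y : ℕ) → x > 0 → y > 0 → (b : Multiseg) → b ≺ Speh x y → map negₛ b ↭ b →
    ((b ↭ ρ x y) ⇔ (¬ (Σ (Fin (length b)) λ i → Σ (Fin (length b)) λ j → i ≢ j × lookup b i ≡ negₛ (lookup b j))))
    × ((¬ (Σ (Fin (length b)) λ i → Σ (Fin (length b)) λ j → i ≢ j × lookup b i ≡ negₛ (lookup b j))) ⇔ (∀ i → lookup b i ≡ negₛ (lookup b i)))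
lemma3p3p1 x y x>0 _ b b≺Speh θ-stable = mk⇔ i⇒ii ii⇒i , mk⇔ ii⇒iii iii⇒ii
  where
  i⇒ii : b ↭ ρ x y → ¬ HasDualPair b
  i⇒ii = ↭ρ⇒¬HasDualPair
  ii⇒iii : ¬ HasDualPair b → AllSelfDual b
  ii⇒iii = θ-stable∧¬HasDualPair⇒AllSelfDual θ-stable
  iii⇒i : AllSelfDual b → b ↭ ρ x y
  iii⇒i = AllSelfDual-≺-Speh⇒↭ρ x>0 b≺Speh
  ii⇒i : ¬ HasDualPair b → b ↭ ρ x y
  ii⇒i = iii⇒i ∘ ii⇒iii
  iii⇒ii : AllSelfDual b → ¬ HasDualPair b
  iii⇒ii = i⇒ii ∘ iii⇒i
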